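{- Fix integers $t\ge0$ and $\ell=2$. Let $\mathbf{x},\mathbf{y}$ be sets of indeterminates, and for $n\ge0$, $0\le i\le 2$, let $a^{(i)}_n(\mathbf{x})\in\mathbb{R}[\mathbf{x}]$, $b_n(\mathbf{y})\in\mathbb{R}[\mathbf{y}]$ be polynomials with nonnegative coefficients. Let $M=[M_{n,k}]_{n,k\ge0}$ be the weighted lattice path matrix defined in the context. Suppose there exist sequences $(\alpha_n(\mathbf{x}))_n$, $(\beta_n(\mathbf{x}))_n$, $(\lambda_n(\mathbf{x}))_n$, $(\mu_n(\mathbf{x}))_n$ of polynomials with nonnegative coefficients such that $a_n^{(0)}=\alpha_n\lambda_n$ for $n\ge0$, $a_n^{(1)}=\alpha_n\mu_n+\beta_n\lambda_{n-1}$ for $n\ge1$, and $a_n^{(2)}=\beta_n\mu_{n-1}$ for $n\ge2$. Then (i) $M$ is $(\mathbf{x},\mathbf{y})$-totally positive; (ii) if $t\ge1$, then for each $n\ge0$ the Toeplitz matrix $[M_{n,i-j}]_{i,j\ge0}$ of the $n$th row sequence of $M$ is $(\mathbf{x},\mathbf{y})$-totally positive (with $M_{n,k}=0$ for $k<0$).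
   Context: For $n,k\ge0$, $M_{n,k}$ is the sum of the weights of all lattice paths in $\mathbb{N}^2$ from $(0,0)$ to $(k,n)$ using the steps $(0,1)$ and $(1,t+i)$ for $0\le i\le\ell$, where each step $(0,1)$ starting at height $n-1$ gets weight $b_n(\mathbf{y})$, each step $(1,t+i)$ starting at height $n-t-i$ gets weight $a^{(i)}_n(\mathbf{x})$, and the weight of a path is the product of the weights of its steps. For a set of indeterminates $\mathbf{z}$, a matrix with entries in $\mathbb{R}[\mathbf{z}]$ is $\mathbf{z}$-totally positive if all its minors are polynomials with nonnegative coefficients in $\mathbf{z}$. -}

module Defs where

open import Level using (Level; _⊔_)
open import Algebra.Bundles using (CommutativeRing)
open import Data.Nat as ℕ using (ℕ; zero; suc; _∸_; _≤ᵇ_)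
open import Data.Bool using (if_then_else_)
open import Data.Fin as Fin using (Fin; zero; suc; punchIn)
open import Relation.Unary using (Pred)

module _ {c ℓ : Level} (R : CommutativeRing c ℓ) where
  open CommutativeRing R using (Carrier; _≈_; 0#; 1#; _+_; _*_; _-_)

  -- A "positive cone": the analogue of "polynomials with nonnegative
  -- coefficients" inside the ring R[x,y]: contains 0 and 1, closed under
  -- + and *, and invariant under the ring equality.
  record PositiveCone {p : Level} (Pos : Pred Carrier p) : Set (c ⊔ ℓ ⊔ p) where
    field
      pos-resp : ∀ {u v} → u ≈ v → Pos u → Pos v
      pos-0    : Pos 0#
      pos-1    : Pos 1#
      pos-+    : ∀ {u v} → Pos u → Pos v → Pos (u + v)
      pos-*    : ∀ {u v} → Pos u → Pos v → Pos (u * v)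

  altSum : (m : ℕ) → (Fin m → Carrier) → Carrier
  altSum zero    f = 0#
  altSum (suc m) f = f zero - altSum m (λ j → f (suc j))

  det : (m : ℕ) → (Fin m → Fin m → Carrier) → Carrier
  det zero    A = 1#
  det (suc m) A =
    altSum (suc m) (λ j → A zero j * det m (λ r s → A (suc r) (punchIn j s)))

  StrictlyIncreasing : {m : ℕ} → (Fin m → ℕ) → Set
  StrictlyIncreasing {m} r = ∀ (i j : Fin m) → i Fin.< j → r i ℕ.< r j

  TotallyPositive : {p : Level} → Pred Carrier p → (ℕ → ℕ → Carrier) → Set p
  TotallyPositive Pos A =
    ∀ (m : ℕ) (rows cols : Fin m → ℕ) →
      StrictlyIncreasing rows → StrictlyIncreasing cols →
      Pos (det m (λ i j → A (rows i) (cols j)))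

  shiftDown : (ℕ → Carrier) → ℕ → ℕ → Carrier
  shiftDown f s n = if s ≤ᵇ n then f (n ∸ s) else 0#

  -- The weighted lattice path matrix, with ℓ = 2.
  -- col t a b k n = M_{n,k} = total weight of paths (0,0) → (k,n) with steps
  -- (0,1) (weight b_n when ending at height n, i.e. starting at height n-1) and
  -- (1,t+i), i = 0,1,2 (weight a^(i)_n when starting at height n-t-i).
  -- Defined by decomposing a path according to its last step.
  -- contribution of the three steps (1,t+i), i = 0,1,2, ending at height n,
  -- given the previous column f = M_{·,k-1}
  sideSteps : (t : ℕ) (a : Fin 3 → ℕ → Carrier) → (ℕ → Carrier) → ℕ → Carrier
  sideSteps t a f n =
      (a zero n * shiftDown f t n
    + a (suc zero) n * shiftDown f (suc t) n)
    + a (suc (suc zero)) n * shiftDown f (suc (suc t)) n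

  col : (t : ℕ) (a : Fin 3 → ℕ → Carrier) (b : ℕ → Carrier) →
        ℕ → ℕ → Carrier
  col t a b zero    zero    = 1#
  col t a b zero    (suc n) = b (suc n) * col t a b zero n
  col t a b (suc k) zero    = sideSteps t a (col t a b k) zero
  col t a b (suc k) (suc n) =
    b (suc n) * col t a b (suc k) n + sideSteps t a (col t a b k) (suc n)

  M : (t : ℕ) (a : Fin 3 → ℕ → Carrier) (b : ℕ → Carrier) → ℕ → ℕ → Carrier
  M t a b n k = col t a b k n

  rowToeplitz : (t : ℕ) (a : Fin 3 → ℕ → Carrier) (b : ℕ → Carrier) →
                ℕ → ℕ → ℕ → Carrier
  rowToeplitz t a b n i j = if j ≤ᵇ i then M t a b n (i ∸ j) else 0#

{-# OPTIONS --safe #-}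
-- Total positivity is propagated by row operations: if row j of B is a Pos-combination of rows
-- j and j ± 1 of A, each minor of B expands into Pos-combinations of minors of A with weakly
-- increasing rows, and those with a repeated row vanish.
--
-- (i) Column k + 1 of M arises from column k by a shift of t rows, the lower bidiagonal
-- matrices with entries λ′, μ and α, β (this is the factorisation of the a⁽ⁱ⁾), a new unit
-- column, and the inverse of the unit bidiagonal matrix with subdiagonal −b.
--
-- (ii) Let T h be the Toeplitz matrix of row h of M.  The rows of T h, T (h − 1), …, T (h − t)
-- and λ′, μ-combinations of them are interleaved into a single matrix S h.  When t ≥ 1, S 0 is
-- a selection matrix and S (h + 1) arises from S h by three bidiagonal row operations and a
-- shift by one row, so every S h, and with it its row-submatrix T h, is totally positive.

module Submission where

open import Defs
open import Level using (Level; _⊔_)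
open import Algebra.Bundles using (CommutativeRing)
open import Data.Bool using (true; false; if_then_else_)
open import Data.Bool.Properties using (if-eta)
open import Data.Empty using (⊥-elim)
open import Data.Fin as Fin using (Fin; zero; suc; punchIn; punchOut; inject₁; lift)
open import Data.Fin.Properties using (punchIn-punchOut; suc-injective)
import Data.Fin.Properties as Finₚ
open import Data.Nat as ℕ using (ℕ; zero; suc; pred; _∸_; _<ᵇ_; _≤ᵇ_; _≤_; _<_; z≤n; s≤s; z<s)
import Data.Nat.Properties as ℕₚ
open import Data.Nat.GeneralisedArithmetic using (fold; iterate; fold-+; iterate-is-fold)
open import Data.Product using (_×_; ∃; _,_; proj₁; proj₂)
open import Data.Sum using (inj₁; inj₂)
open import Data.Unit using (⊤; tt)
open import Data.Vec.Functional using (updateAt)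
open import Data.Vec.Functional.Properties using (updateAt-updates; updateAt-minimal)
open import Function using (_∘_; const)
open import Relation.Binary.Definitions using (tri<; tri≈; tri>)
open import Relation.Binary.PropositionalEquality as ≡ using (_≡_; _≢_)
open import Relation.Nullary using (Dec; yes; no)
open import Relation.Unary using (Pred)

<ᵇ-true : ∀ {m n} → m < n → (m <ᵇ n) ≡ true
<ᵇ-true {zero}  (s≤s _)   = ≡.refl
<ᵇ-true {suc m} (s≤s m<n) = <ᵇ-true m<n

<ᵇ-false : ∀ {m n} → n ≤ m → (m <ᵇ n) ≡ false
<ᵇ-false z≤n       = ≡.refl
<ᵇ-false (s≤s n≤m) = <ᵇ-false n≤m

≤ᵇ-true : ∀ {m n} → m ≤ n → (m ≤ᵇ n) ≡ true
≤ᵇ-true z≤n         = ≡.refl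
≤ᵇ-true m≤n@(s≤s _) = <ᵇ-true m≤n

≤ᵇ-false : ∀ {m n} → n < m → (m ≤ᵇ n) ≡ false
≤ᵇ-false (s≤s n≤m) = <ᵇ-false n≤m

pred-< : ∀ {m n} → 0 < m → m < n → pred m < pred n
pred-< (s≤s _) (s≤s m<n) = m<n

ascending⇒< : ∀ {σ : ℕ → ℕ} → (∀ j → σ j < σ (suc j)) → ∀ {i j} → i < j → σ i < σ j
ascending⇒< σ↑ {i} {suc j} (s≤s i≤j) with ℕₚ.m≤n⇒m<n∨m≡n i≤j
... | inj₁ i<j    = ℕₚ.<-trans (ascending⇒< σ↑ i<j) (σ↑ j)
... | inj₂ ≡.refl = σ↑ i

upperBound : ∀ m (f : Fin m → ℕ) → ∃ λ N → ∀ i → f i < N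
upperBound zero    f = 0 , λ ()
upperBound (suc m) f with upperBound m (f ∘ suc)
... | N , f<N = suc (f zero ℕ.+ N) , λ where
  zero    → s≤s (ℕₚ.m≤m+n (f zero) N)
  (suc i) → ℕₚ.≤-trans (f<N i) (ℕₚ.m≤n⇒m≤1+n (ℕₚ.m≤n+m N (f zero)))

m∸n≡1+m∸1+n : ∀ {m n} → n < m → m ∸ n ≡ suc (m ∸ suc n)
m∸n≡1+m∸1+n {suc m} (s≤s n≤m) = ℕₚ.+-∸-assoc 1 n≤m

module RingIdentities {c ℓ : Level} (R : CommutativeRing c ℓ) where
  open CommutativeRing R

  1*x+0*y≈x : ∀ x y → 1# * x + 0# * y ≈ x
  1*x+0*y≈x x y = trans (+-cong (*-identityˡ x) (zeroˡ y)) (+-identityʳ x)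

  0*x+1*y≈y : ∀ x y → 0# * x + 1# * y ≈ y
  0*x+1*y≈y x y = trans (+-cong (zeroˡ x) (*-identityˡ y)) (+-identityˡ y)

  0*x+0*y≈0 : ∀ x y → 0# * x + 0# * y ≈ 0#
  0*x+0*y≈0 x y = trans (+-cong (zeroˡ x) (zeroˡ y)) (+-identityʳ 0#)

module Determinant {c ℓ : Level} (R : CommutativeRing c ℓ) where
  open CommutativeRing R hiding (zero)
  open RingIdentities R
  open import Algebra.Properties.Ring ring using (-0#≈0#; -‿+-comm; ⁻¹-anti-homo‿-; xyx⁻¹≈y; x[y-z]≈xy-xz)
  open import Algebra.Properties.CommutativeSemigroup *-commutativeSemigroup using (x∙yz≈y∙xz)
  open import Algebra.Solver.Ring.NaturalCoefficients.Default commutativeSemiring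
  open import Relation.Binary.Reasoning.Setoid setoid

  Square : ℕ → Set c
  Square m = Fin m → Fin m → Carrier

  deleteRow₀Column : ∀ {m} → Square (suc m) → Fin (suc m) → Square m
  deleteRow₀Column A j r s = A (suc r) (punchIn j s)

  firstRowMinor : ∀ {m} → Square (suc m) → Fin (suc m) → Carrier
  firstRowMinor {m} A j = det R m (deleteRow₀Column A j)

  altSum-cong : ∀ m {f g : Fin m → Carrier} → (∀ j → f j ≈ g j) → altSum R m f ≈ altSum R m g
  altSum-cong zero    f≈g = refl
  altSum-cong (suc m) f≈g = +-cong (f≈g zero) (-‿cong (altSum-cong m (f≈g ∘ suc)))

  altSum-≈0 : ∀ m {f : Fin m → Carrier} → (∀ j → f j ≈ 0#) → altSum R m f ≈ 0#
  altSum-≈0 zero    f≈0 = refl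
  altSum-≈0 (suc m) {f} f≈0 = begin
    f zero - altSum R m (f ∘ suc) ≈⟨ +-cong (f≈0 zero) (-‿cong (altSum-≈0 m (f≈0 ∘ suc))) ⟩
    0# - 0#                       ≈⟨ -‿inverseʳ 0# ⟩
    0#                            ∎

  altSum-+ : ∀ m (f g : Fin m → Carrier) → altSum R m (λ j → f j + g j) ≈ altSum R m f + altSum R m g
  altSum-+ zero    f g = sym (+-identityˡ 0#)
  altSum-+ (suc m) f g = begin
    (f zero + g zero) - altSum R m (λ j → f (suc j) + g (suc j))
      ≈⟨ +-congˡ (-‿cong (altSum-+ m (f ∘ suc) (g ∘ suc))) ⟩
    (f zero + g zero) - (altSum R m (f ∘ suc) + altSum R m (g ∘ suc))
      ≈⟨ +-congˡ (sym (-‿+-comm _ _)) ⟩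
    (f zero + g zero) + (- altSum R m (f ∘ suc) + - altSum R m (g ∘ suc))
      ≈⟨ solve 4 (λ a b x y → (a :+ b) :+ (x :+ y) := (a :+ x) :+ (b :+ y)) refl
           (f zero) (g zero) (- altSum R m (f ∘ suc)) (- altSum R m (g ∘ suc)) ⟩
    altSum R (suc m) f + altSum R (suc m) g ∎

  altSum-*ˡ : ∀ m x (f : Fin m → Carrier) → altSum R m (λ j → x * f j) ≈ x * altSum R m f
  altSum-*ˡ zero    x f = sym (zeroʳ x)
  altSum-*ˡ (suc m) x f = begin
    x * f zero - altSum R m (λ j → x * f (suc j)) ≈⟨ +-congˡ (-‿cong (altSum-*ˡ m x (f ∘ suc))) ⟩
    x * f zero - x * altSum R m (f ∘ suc)         ≈⟨ sym (x[y-z]≈xy-xz x (f zero) (altSum R m (f ∘ suc))) ⟩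
    x * altSum R (suc m) f                        ∎

  altSum-- : ∀ m (f g : Fin m → Carrier) → altSum R m (λ j → f j - g j) ≈ altSum R m f - altSum R m g
  altSum-- zero    f g = sym (-‿inverseʳ 0#)
  altSum-- (suc m) f g = begin
    (f zero - g zero) - altSum R m (λ j → f (suc j) - g (suc j))
      ≈⟨ +-congˡ (-‿cong (altSum-- m (f ∘ suc) (g ∘ suc))) ⟩
    (f zero - g zero) - (altSum R m (f ∘ suc) - altSum R m (g ∘ suc))
      ≈⟨ +-congˡ (⁻¹-anti-homo‿- _ _) ⟩
    (f zero - g zero) + (altSum R m (g ∘ suc) - altSum R m (f ∘ suc))
      ≈⟨ solve 4 (λ a b x y → (a :+ b) :+ (y :+ x) := (a :+ x) :+ (y :+ b)) refl
           (f zero) (- g zero) (- altSum R m (f ∘ suc)) (altSum R m (g ∘ suc)) ⟩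
    (f zero - altSum R m (f ∘ suc)) + (altSum R m (g ∘ suc) - g zero)
      ≈⟨ +-congˡ (sym (⁻¹-anti-homo‿- _ _)) ⟩
    altSum R (suc m) f - altSum R (suc m) g ∎

  altSum-linear : ∀ m x y (f g : Fin m → Carrier) →
    altSum R m (λ j → x * f j + y * g j) ≈ x * altSum R m f + y * altSum R m g
  altSum-linear m x y f g =
    trans (altSum-+ m _ _) (+-cong (altSum-*ˡ m x f) (altSum-*ˡ m y g))

  det-cong : ∀ m {A B : Square m} → (∀ r s → A r s ≈ B r s) → det R m A ≈ det R m B
  det-cong zero    A≈B = refl
  det-cong (suc m) A≈B = altSum-cong (suc m) λ j →
    *-cong (A≈B zero j) (det-cong m (λ r s → A≈B (suc r) (punchIn j s)))

  det-linear : ∀ m (A B C : Square m) (p : Fin m) x y →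
    (∀ s → A p s ≈ x * B p s + y * C p s) →
    (∀ r → r ≢ p → ∀ s → A r s ≈ B r s) →
    (∀ r → r ≢ p → ∀ s → A r s ≈ C r s) →
    det R m A ≈ x * det R m B + y * det R m C
  det-linear (suc m) A B C p x y Aₚ≈ A≈B A≈C =
    trans (altSum-cong (suc m) (term p Aₚ≈ A≈B A≈C))
          (altSum-linear (suc m) x y (λ j → B zero j * firstRowMinor B j) (λ j → C zero j * firstRowMinor C j))
    where
    term : ∀ p → (∀ s → A p s ≈ x * B p s + y * C p s) →
      (∀ r → r ≢ p → ∀ s → A r s ≈ B r s) → (∀ r → r ≢ p → ∀ s → A r s ≈ C r s) →
      ∀ j → A zero j * firstRowMinor A j ≈ x * (B zero j * firstRowMinor B j) + y * (C zero j * firstRowMinor C j)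
    term zero A₀≈ A≈B A≈C j = begin
      A zero j * firstRowMinor A j
        ≈⟨ *-cong (A₀≈ j) refl ⟩
      (x * B zero j + y * C zero j) * firstRowMinor A j
        ≈⟨ solve 5 (λ x y b c d → (x :* b :+ y :* c) :* d := x :* (b :* d) :+ y :* (c :* d)) refl
             x y (B zero j) (C zero j) (firstRowMinor A j) ⟩
      x * (B zero j * firstRowMinor A j) + y * (C zero j * firstRowMinor A j)
        ≈⟨ +-cong (*-congˡ (*-congˡ (det-cong m (λ r s → A≈B (suc r) (λ ()) (punchIn j s)))))
                  (*-congˡ (*-congˡ (det-cong m (λ r s → A≈C (suc r) (λ ()) (punchIn j s))))) ⟩
      x * (B zero j * firstRowMinor B j) + y * (C zero j * firstRowMinor C j) ∎
    term (suc p) Aₚ≈ A≈B A≈C j = begin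
      A zero j * firstRowMinor A j
        ≈⟨ *-congˡ (det-linear m (deleteRow₀Column A j) (deleteRow₀Column B j) (deleteRow₀Column C j) p x y
             (Aₚ≈ ∘ punchIn j)
             (λ r r≢p s → A≈B (suc r) (r≢p ∘ suc-injective) (punchIn j s))
             (λ r r≢p s → A≈C (suc r) (r≢p ∘ suc-injective) (punchIn j s))) ⟩
      A zero j * (x * firstRowMinor B j + y * firstRowMinor C j)
        ≈⟨ solve 5 (λ a x y b c → a :* (x :* b :+ y :* c) := x :* (a :* b) :+ y :* (a :* c)) refl
             (A zero j) x y (firstRowMinor B j) (firstRowMinor C j) ⟩
      x * (A zero j * firstRowMinor B j) + y * (A zero j * firstRowMinor C j)
        ≈⟨ +-cong (*-congˡ (*-congʳ (A≈B zero (λ ()) j))) (*-congˡ (*-congʳ (A≈C zero (λ ()) j))) ⟩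
      x * (B zero j * firstRowMinor B j) + y * (C zero j * firstRowMinor C j) ∎

  det-zeroRow : ∀ m (A : Square m) (p : Fin m) → (∀ s → A p s ≈ 0#) → det R m A ≈ 0#
  det-zeroRow m A p Aₚ≈0 = begin
    det R m A                           ≈⟨ det-linear m A A A p 0# 0# Aₚ≈0+0 (λ _ _ _ → refl) (λ _ _ _ → refl) ⟩
    0# * det R m A + 0# * det R m A     ≈⟨ 0*x+0*y≈0 _ _ ⟩
    0#                                  ∎
    where
    Aₚ≈0+0 : ∀ s → A p s ≈ 0# * A p s + 0# * A p s
    Aₚ≈0+0 s = trans (Aₚ≈0 s) (sym (0*x+0*y≈0 _ _))

  det-zeroColumn : ∀ m (A : Square m) (q : Fin m) → (∀ r → A r q ≈ 0#) → det R m A ≈ 0#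
  det-zeroColumn (suc m) A q A·q≈0 = altSum-≈0 (suc m) term
    where
    term : ∀ j → A zero j * firstRowMinor A j ≈ 0#
    term j with j Fin.≟ q
    ... | yes ≡.refl = trans (*-congʳ (A·q≈0 zero)) (zeroˡ _)
    ... | no  j≢q    = trans (*-congˡ (det-zeroColumn m (deleteRow₀Column A j) (punchOut j≢q) λ r →
                         trans (reflexive (≡.cong (A (suc r)) (punchIn-punchOut j≢q))) (A·q≈0 (suc r))))
                       (zeroʳ _)

  det-unitColumn : ∀ m (A : Square (suc m)) → A zero zero ≈ 1# → (∀ r → A (suc r) zero ≈ 0#) →
    det R (suc m) A ≈ det R m (λ r s → A (suc r) (suc s))
  det-unitColumn m A A₀₀≈1 A·₀≈0 = begin
    A zero zero * D - altSum R m (λ j → A zero (suc j) * firstRowMinor A (suc j))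
      ≈⟨ +-cong (*-congʳ A₀₀≈1) (-‿cong (altSum-≈0 m λ j → trans (*-congˡ (minor≈0 m A A·₀≈0 j)) (zeroʳ _))) ⟩
    1# * D - 0#
      ≈⟨ +-cong (*-identityˡ D) -0#≈0# ⟩
    D + 0#
      ≈⟨ +-identityʳ D ⟩
    D ∎
    where
    D = det R m (λ r s → A (suc r) (suc s))
    minor≈0 : ∀ m (A : Square (suc m)) → (∀ r → A (suc r) zero ≈ 0#) → ∀ j → firstRowMinor A (suc j) ≈ 0#
    minor≈0 (suc m) A A·₀≈0 j = det-zeroColumn (suc m) (deleteRow₀Column A (suc j)) zero A·₀≈0

  private
    -- The expansion of a determinant along its first two rows when both equal a;
    -- X σ is the minor of the remaining rows on the columns σ.
    doubleExpansion : ∀ n → (Fin (suc (suc n)) → Carrier) → ((Fin n → Fin (suc (suc n))) → Carrier) → Carrier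
    doubleExpansion n a X = altSum R (suc (suc n)) λ j →
      a j * altSum R (suc n) (λ k → a (punchIn j k) * X (punchIn j ∘ punchIn k))

    -- The terms with j = 0 cancel those with k = 0.
    doubleExpansion≈tail : ∀ n a X → doubleExpansion n a X ≈ altSum R (suc n) λ j →
      a (suc j) * altSum R n (λ k → a (suc (punchIn j k)) * X (punchIn (suc j) ∘ punchIn (suc k)))
    doubleExpansion≈tail n a X = begin
      a zero * S₀ - altSum R (suc n) (λ j → a (suc j) * (a zero * X (suc ∘ punchIn j) - T j))
        ≈⟨ +-congˡ (-‿cong (altSum-cong (suc n) λ j →
             trans (x[y-z]≈xy-xz (a (suc j)) (a zero * X (suc ∘ punchIn j)) (T j))
                   (+-congʳ (x∙yz≈y∙xz (a (suc j)) (a zero) (X (suc ∘ punchIn j)))))) ⟩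
      a zero * S₀ - altSum R (suc n) (λ j → a zero * (a (suc j) * X (suc ∘ punchIn j)) - a (suc j) * T j)
        ≈⟨ +-congˡ (-‿cong (trans
             (altSum-- (suc n) (λ j → a zero * (a (suc j) * X (suc ∘ punchIn j))) (λ j → a (suc j) * T j))
                                  (+-congʳ (altSum-*ˡ (suc n) (a zero) (λ j → a (suc j) * X (suc ∘ punchIn j)))))) ⟩
      a zero * S₀ - (a zero * S₀ - altSum R (suc n) (λ j → a (suc j) * T j))
        ≈⟨ +-congˡ (⁻¹-anti-homo‿- _ _) ⟩
      a zero * S₀ + (altSum R (suc n) (λ j → a (suc j) * T j) - a zero * S₀)
        ≈⟨ trans (sym (+-assoc _ _ _)) (xyx⁻¹≈y _ _) ⟩
      altSum R (suc n) (λ j → a (suc j) * T j) ∎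
      where
      S₀ = altSum R (suc n) (λ k → a (suc k) * X (suc ∘ punchIn k))
      T : Fin (suc n) → Carrier
      T j = altSum R n (λ k → a (suc (punchIn j k)) * X (punchIn (suc j) ∘ punchIn (suc k)))

    doubleExpansion≈0 : ∀ n a X → (∀ σ τ → (∀ s → σ s ≡ τ s) → X σ ≈ X τ) → doubleExpansion n a X ≈ 0#
    doubleExpansion≈0 zero a X X-ext = trans (doubleExpansion≈tail zero a X)
      (altSum-≈0 1 {λ j → a (suc j) * 0#} λ { zero → zeroʳ (a (suc zero)) })
    doubleExpansion≈0 (suc n) a X X-ext = begin
      doubleExpansion (suc n) a X
        ≈⟨ doubleExpansion≈tail (suc n) a X ⟩
      _
        ≈⟨ altSum-cong (suc (suc n)) (λ j → *-congˡ {a (suc j)} (altSum-cong (suc n) λ k →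
             *-congˡ {a (suc (punchIn j k))}
               (X-ext (punchIn (suc j) ∘ punchIn (suc k)) (lift 1 (punchIn j ∘ punchIn k))
                 λ { zero → ≡.refl ; (suc s) → ≡.refl }))) ⟩
      doubleExpansion n (a ∘ suc) (X ∘ lift 1)
        ≈⟨ doubleExpansion≈0 n (a ∘ suc) (X ∘ lift 1) (λ σ τ σ≗τ → X-ext (lift 1 σ) (lift 1 τ)
             λ { zero → ≡.refl ; (suc s) → ≡.cong suc (σ≗τ s) }) ⟩
      0# ∎

  det-equalAdjacentRows : ∀ m (A : Square (suc m)) (p : Fin m) →
    (∀ s → A (inject₁ p) s ≈ A (suc p) s) → det R (suc m) A ≈ 0#
  det-equalAdjacentRows (suc m) A (suc p) Aₚ≈Aₚ₊₁ = altSum-≈0 (suc (suc m)) λ j →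
    trans (*-congˡ (det-equalAdjacentRows m (deleteRow₀Column A j) p (Aₚ≈Aₚ₊₁ ∘ punchIn j))) (zeroʳ (A zero j))
  det-equalAdjacentRows (suc m) A zero A₀≈A₁ = begin
    det R (suc (suc m)) A
      ≈⟨ altSum-cong (suc (suc m)) (λ j → *-congˡ {A zero j} (altSum-cong (suc m) λ k →
           *-congʳ {det R m (λ r s → A (suc (suc r)) (punchIn j (punchIn k s)))} (sym (A₀≈A₁ (punchIn j k))))) ⟩
    doubleExpansion m (A zero) X
      ≈⟨ doubleExpansion≈0 m (A zero) X
           (λ σ τ σ≗τ → det-cong m (λ r s → reflexive (≡.cong (A (suc (suc r))) (σ≗τ s)))) ⟩
    0# ∎
    where
    X : (Fin m → Fin (suc (suc m))) → Carrier
    X σ = det R m (λ r s → A (suc (suc r)) (σ s))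

module TotalPositivity {c ℓ p : Level} (R : CommutativeRing c ℓ) (Pos : Pred (CommutativeRing.Carrier R) p)
                       (cone : PositiveCone R Pos) where
  open CommutativeRing R hiding (zero)
  open PositiveCone cone
  open Determinant R
  open RingIdentities R

  Matrix : Set c
  Matrix = ℕ → ℕ → Carrier

  minor : Matrix → ∀ {m} → (Fin m → ℕ) → (Fin m → ℕ) → Carrier
  minor A {m} ρ κ = det R m (λ i j → A (ρ i) (κ j))

  Increasing : ∀ {m} → (Fin m → ℕ) → Set
  Increasing = StrictlyIncreasing R

  TotallyPositive< : ℕ → Matrix → Set p
  TotallyPositive< K A = ∀ m (ρ κ : Fin m → ℕ) → Increasing ρ → Increasing κ → (∀ j → κ j < K) →
    Pos (minor A ρ κ)

  TP<⇒TP : ∀ {A} → (∀ K → TotallyPositive< K A) → TotallyPositive R Pos A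
  TP<⇒TP A-tp m ρ κ ρ↑ κ↑ = A-tp (proj₁ (upperBound m κ)) m ρ κ ρ↑ κ↑ (proj₂ (upperBound m κ))

  TP<-zero : ∀ {A} → TotallyPositive< 0 A
  TP<-zero zero    ρ κ _ _ _   = pos-1
  TP<-zero (suc m) ρ κ _ _ κ<0 with κ<0 zero
  ... | ()

  TP<-resp : ∀ {K A B} → (∀ n k → A n k ≈ B n k) → TotallyPositive< K A → TotallyPositive< K B
  TP<-resp A≈B A-tp m ρ κ ρ↑ κ↑ κ<K = pos-resp (det-cong m λ i j → A≈B (ρ i) (κ j)) (A-tp m ρ κ ρ↑ κ↑ κ<K)

  TP<-selectRows : ∀ {K A} (σ : ℕ → ℕ) → (∀ j → σ j < σ (suc j)) → TotallyPositive< K A →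
    TotallyPositive< K (λ n k → A (σ n) k)
  TP<-selectRows σ σ↑ A-tp m ρ κ ρ↑ κ↑ κ<K = A-tp m (σ ∘ ρ) κ (λ i j i<j → ascending⇒< σ↑ (ρ↑ i j i<j)) κ↑ κ<K

  increasing-head≤ : ∀ {m} {f : Fin (suc m) → ℕ} → Increasing f → ∀ i → f zero ≤ f i
  increasing-head≤ f↑ zero    = ℕₚ.≤-refl
  increasing-head≤ f↑ (suc i) = ℕₚ.<⇒≤ (f↑ zero (suc i) z<s)

  increasing-injective : ∀ {m} {f : Fin m → ℕ} → Increasing f → ∀ {i j} → f i ≡ f j → i ≡ j
  increasing-injective f↑ {i} {j} fi≡fj with Finₚ.<-cmp i j
  ... | tri< i<j _ _ = ⊥-elim (ℕₚ.<⇒≢ (f↑ i j i<j) fi≡fj)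
  ... | tri≈ _ i≡j _ = i≡j
  ... | tri> _ _ j<i = ⊥-elim (ℕₚ.<⇒≢ (f↑ j i j<i) (≡.sym fi≡fj))

  increasing-fromAdjacent : ∀ {m} (f : Fin (suc m) → ℕ) → (∀ q → f (inject₁ q) < f (suc q)) → Increasing f
  increasing-fromAdjacent {suc m} f f↑ zero    (suc j) _         =
    ℕₚ.<-≤-trans (f↑ zero) (increasing-head≤ (increasing-fromAdjacent (f ∘ suc) (f↑ ∘ suc)) j)
  increasing-fromAdjacent {suc m} f f↑ (suc i) (suc j) (s≤s i<j) =
    increasing-fromAdjacent (f ∘ suc) (f↑ ∘ suc) i j i<j

  TP<-weaklyIncreasingRows : ∀ {K A} → TotallyPositive< K A → ∀ {m} (ρ κ : Fin (suc m) → ℕ) →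
    (∀ q → ρ (inject₁ q) ≤ ρ (suc q)) → Increasing κ → (∀ j → κ j < K) → Pos (minor A ρ κ)
  TP<-weaklyIncreasingRows {K} {A} A-tp {m} ρ κ ρ↗ κ↑ κ<K with Finₚ.any? (λ q → ρ (inject₁ q) ℕ.≟ ρ (suc q))
  ... | yes (q , ρq≡ρq+1) = pos-resp
          (sym (det-equalAdjacentRows m (λ i j → A (ρ i) (κ j)) q λ s → reflexive (≡.cong (λ n → A n (κ s)) ρq≡ρq+1)))
          pos-0
  ... | no  ρ-distinct    = A-tp (suc m) ρ κ
          (increasing-fromAdjacent ρ λ q → ℕₚ.≤∧≢⇒< (ρ↗ q) (ρ-distinct ∘ (q ,_))) κ↑ κ<K

  updateAt-weaklyIncreasing : ∀ {m} (ρ : Fin (suc m) → ℕ) → Increasing ρ → ∀ p {v} →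
    pred (ρ p) ≤ v → v ≤ suc (ρ p) → ∀ q → updateAt ρ p (const v) (inject₁ q) ≤ updateAt ρ p (const v) (suc q)
  updateAt-weaklyIncreasing ρ ρ↑ p {v} ρₚ-1≤v v≤ρₚ+1 q with inject₁ q Fin.≟ p | suc q Fin.≟ p
  ... | yes ≡.refl | _          = begin
    ρ′ (inject₁ q)      ≡⟨ updateAt-updates (inject₁ q) ρ ⟩
    v                   ≤⟨ v≤ρₚ+1 ⟩
    suc (ρ (inject₁ q)) ≤⟨ ρ↑ (inject₁ q) (suc q) q<q+1 ⟩
    ρ (suc q)           ≡⟨ updateAt-minimal (suc q) (inject₁ q) ρ (Finₚ.<⇒≢ q<q+1 ∘ ≡.sym) ⟨
    ρ′ (suc q)          ∎
    where
    open ℕₚ.≤-Reasoning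
    ρ′ = updateAt ρ p (const v)
    q<q+1 = Finₚ.≤̄⇒inject₁< Finₚ.≤-refl
  ... | no  q≢p    | yes ≡.refl = begin
    ρ′ (inject₁ q)      ≡⟨ updateAt-minimal (inject₁ q) (suc q) ρ q≢p ⟩
    ρ (inject₁ q)       ≤⟨ ℕₚ.<⇒≤pred (ρ↑ (inject₁ q) (suc q) (Finₚ.≤̄⇒inject₁< Finₚ.≤-refl)) ⟩
    pred (ρ (suc q))    ≤⟨ ρₚ-1≤v ⟩
    v                   ≡⟨ updateAt-updates (suc q) ρ ⟨
    ρ′ (suc q)          ∎
    where
    open ℕₚ.≤-Reasoning
    ρ′ = updateAt ρ p (const v)
  ... | no  q≢p    | no  q+1≢p  = begin
    ρ′ (inject₁ q)      ≡⟨ updateAt-minimal (inject₁ q) p ρ q≢p ⟩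
    ρ (inject₁ q)       ≤⟨ ℕₚ.<⇒≤ (ρ↑ (inject₁ q) (suc q) (Finₚ.≤̄⇒inject₁< Finₚ.≤-refl)) ⟩
    ρ (suc q)           ≡⟨ updateAt-minimal (suc q) p ρ q+1≢p ⟨
    ρ′ (suc q)          ∎
    where
    open ℕₚ.≤-Reasoning
    ρ′ = updateAt ρ p (const v)

  -- Expand a minor of B linearly in row j.  Because j′ is adjacent to j, substituting j′ for j
  -- leaves the row indices weakly increasing, and a repeated row gives a vanishing minor.
  TP<-rowCombination : ∀ {K A B} j j′ {c d} → Pos c → Pos d → pred j ≤ j′ → j′ ≤ suc j →
    (∀ n → n ≢ j → ∀ k → B n k ≈ A n k) → (∀ k → B j k ≈ c * A j k + d * A j′ k) →
    TotallyPositive< K A → TotallyPositive< K B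
  TP<-rowCombination {K} {A} {B} j j′ {c} {d} c⁺ d⁺ j-1≤j′ j′≤j+1 B≈A B-row≈ A-tp m ρ κ ρ↑ κ↑ κ<K
    with Finₚ.any? (λ i → ρ i ℕ.≟ j)
  ... | no  j∉ρ = pos-resp (det-cong m λ r s → sym (B≈A (ρ r) (j∉ρ ∘ (r ,_)) (κ s))) (A-tp m ρ κ ρ↑ κ↑ κ<K)
  TP<-rowCombination {K} {A} {B} _ j′ {c} {d} c⁺ d⁺ j-1≤j′ j′≤j+1 B≈A B-row≈ A-tp (suc m) ρ κ ρ↑ κ↑ κ<K
    | yes (p , ≡.refl) = pos-resp (sym B-minor≈) (pos-+ (pos-* c⁺ (A-tp (suc m) ρ κ ρ↑ κ↑ κ<K))
        (pos-* d⁺ (TP<-weaklyIncreasingRows {A = A} A-tp ρ′ κ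
                    (updateAt-weaklyIncreasing ρ ρ↑ p j-1≤j′ j′≤j+1) κ↑ κ<K)))
    where
    ρ′ : Fin (suc m) → ℕ
    ρ′ = updateAt ρ p (const j′)

    B-minor≈ : minor B ρ κ ≈ c * minor A ρ κ + d * minor A ρ′ κ
    B-minor≈ = det-linear (suc m) _ _ _ p c d
      (λ s → trans (B-row≈ (κ s))
                   (+-congˡ (*-congˡ (reflexive (≡.cong (λ n → A n (κ s)) (≡.sym (updateAt-updates p ρ)))))))
      (λ r r≢p s → B≈A (ρ r) (r≢p ∘ increasing-injective ρ↑) (κ s))
      (λ r r≢p s → trans (B≈A (ρ r) (r≢p ∘ increasing-injective ρ↑) (κ s))
                         (reflexive (≡.cong (λ n → A n (κ s)) (≡.sym (updateAt-minimal r p ρ r≢p)))))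

  splice : ℕ → Matrix → Matrix → Matrix
  splice j B A n k = if n <ᵇ j then B n k else A n k

  splice-above : ∀ {j n} B A k → n < j → splice j B A n k ≡ B n k
  splice-above B A k n<j rewrite <ᵇ-true n<j = ≡.refl

  splice-below : ∀ {j n} B A k → j ≤ n → splice j B A n k ≡ A n k
  splice-below B A k j≤n rewrite <ᵇ-false j≤n = ≡.refl

  splice-suc : ∀ {j n} B A k → n ≢ j → splice (suc j) B A n k ≡ splice j B A n k
  splice-suc {j} {n} B A k n≢j with ℕₚ.<-cmp n j
  ... | tri< n<j _ _ = ≡.trans (splice-above B A k (ℕₚ.m<n⇒m<1+n n<j)) (≡.sym (splice-above B A k n<j))
  ... | tri≈ _ n≡j _ = ⊥-elim (n≢j n≡j)
  ... | tri> _ _ j<n = ≡.trans (splice-below B A k j<n) (≡.sym (splice-below B A k (ℕₚ.<⇒≤ j<n)))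

  zeroᴹ : Matrix
  zeroᴹ _ _ = 0#

  TP<-truncate : ∀ {K A} N → TotallyPositive< K A → TotallyPositive< K (splice N A zeroᴹ)
  TP<-truncate {K} {A} N A-tp m ρ κ ρ↑ κ↑ κ<K with Finₚ.any? (λ i → N ℕ.≤? ρ i)
  ... | yes (i , N≤ρi) = pos-resp (sym (det-zeroRow m _ i λ s → reflexive (splice-below A zeroᴹ (κ s) N≤ρi))) pos-0
  ... | no  ρ<N        = pos-resp
                           (det-cong m λ i s → sym (reflexive (splice-above A zeroᴹ (κ s) (ℕₚ.≰⇒> (ρ<N ∘ (i ,_))))))
                           (A-tp m ρ κ ρ↑ κ↑ κ<K)

  -- B = L A for a lower bidiagonal L.  The rows have to be replaced from the bottom up, so the
  -- matrices are first truncated below the rows of the minor at hand.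
  TP<-lowerBidiagonal : ∀ {K A B} (c d : ℕ → Carrier) → (∀ n → Pos (c n)) → (∀ n → Pos (d n)) →
    (∀ n k → B n k ≈ c n * A n k + d n * A (pred n) k) →
    TotallyPositive< K A → TotallyPositive< K B
  TP<-lowerBidiagonal {K} {A} {B} c d c⁺ d⁺ B≈ A-tp m ρ κ ρ↑ κ↑ κ<K =
    pos-resp (det-cong m λ i s → reflexive (splice-above B zeroᴹ (κ s) (ρ<N i)))
             (descend N (ℕₚ.+-identityʳ N) m ρ κ ρ↑ κ↑ κ<K)
    where
    N = proj₁ (upperBound m ρ)
    ρ<N = proj₂ (upperBound m ρ)

    B↾N : Matrix
    B↾N = splice N B zeroᴹ

    H : ℕ → Matrix
    H j = splice j A B↾N

    H-step : ∀ j → j < N → TotallyPositive< K (H (suc j)) → TotallyPositive< K (H j)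
    H-step j j<N = TP<-rowCombination {A = H (suc j)} {B = H j} j (pred j) (c⁺ j) (d⁺ j)
      ℕₚ.≤-refl (ℕₚ.≤-trans ℕₚ.pred[n]≤n (ℕₚ.n≤1+n j))
      (λ n n≢j k → reflexive (≡.sym (splice-suc A B↾N k n≢j)))
      (λ k → begin
        H j j k
          ≡⟨ ≡.trans (splice-below A B↾N k ℕₚ.≤-refl) (splice-above B zeroᴹ k j<N) ⟩
        B j k
          ≈⟨ B≈ j k ⟩
        c j * A j k + d j * A (pred j) k
          ≡⟨ ≡.cong₂ (λ x y → c j * x + d j * y)
               (splice-above A B↾N k (ℕₚ.n<1+n j)) (splice-above A B↾N k (s≤s ℕₚ.pred[n]≤n)) ⟨
        c j * H (suc j) j k + d j * H (suc j) (pred j) k ∎)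
      where open import Relation.Binary.Reasoning.Setoid setoid

    descend : ∀ i {j} → i ℕ.+ j ≡ N → TotallyPositive< K (H j)
    descend zero    ≡.refl = TP<-resp H≈ (TP<-truncate {A = A} N A-tp)
      where
      H≈ : ∀ n k → splice N A zeroᴹ n k ≈ H N n k
      H≈ n k with n <ᵇ N
      ... | true  = refl
      ... | false = refl
    descend (suc i) {j} i+1+j≡N = H-step j (≡.subst (j <_) i+1+j≡N (s≤s (ℕₚ.m≤n+m j i)))
                                          (descend i (≡.trans (ℕₚ.+-suc i j) i+1+j≡N))

  -- Rows are replaced from the top down: row n of B combines row n of A with row j′ n of the
  -- matrix whose rows above n are already those of B.
  TP<-rowByRow : ∀ {K A B} (j′ : ℕ → ℕ) (c d : ℕ → Carrier) → (∀ n → Pos (c n)) → (∀ n → Pos (d n)) →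
    (∀ n → pred n ≤ j′ n) → (∀ n → j′ n ≤ suc n) →
    (∀ n k → B n k ≈ c n * A n k + d n * splice n B A (j′ n) k) →
    TotallyPositive< K A → TotallyPositive< K B
  TP<-rowByRow {K} {A} {B} j′ c d c⁺ d⁺ j′-lo j′-hi B≈ A-tp m ρ κ ρ↑ κ↑ κ<K =
    pos-resp (det-cong m λ i s → reflexive (splice-above B A (κ s) (proj₂ (upperBound m ρ) i)))
             (sweep (proj₁ (upperBound m ρ)) m ρ κ ρ↑ κ↑ κ<K)
    where
    sweep : ∀ j → TotallyPositive< K (splice j B A)
    sweep zero    = A-tp
    sweep (suc j) = TP<-rowCombination {A = splice j B A} {B = splice (suc j) B A} j (j′ j) (c⁺ j) (d⁺ j)
      (j′-lo j) (j′-hi j)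
      (λ n n≢j k → reflexive (splice-suc B A k n≢j))
      (λ k → trans (reflexive (splice-above B A k (ℕₚ.n<1+n j)))
                   (trans (B≈ j k) (+-congʳ (*-congˡ (reflexive (≡.sym (splice-below B A k ℕₚ.≤-refl)))))))
      (sweep j)

  TP<-upperBidiagonal : ∀ {K A B} (c d : ℕ → Carrier) → (∀ n → Pos (c n)) → (∀ n → Pos (d n)) →
    (∀ n k → B n k ≈ c n * A n k + d n * A (suc n) k) →
    TotallyPositive< K A → TotallyPositive< K B
  TP<-upperBidiagonal {A = A} {B} c d c⁺ d⁺ B≈ = TP<-rowByRow suc c d c⁺ d⁺
    (λ n → ℕₚ.≤-trans ℕₚ.pred[n]≤n (ℕₚ.n≤1+n n)) (λ _ → ℕₚ.≤-refl)
    (λ n k → trans (B≈ n k) (+-congˡ (*-congˡ (reflexive (≡.sym (splice-below B A k (ℕₚ.n≤1+n n)))))))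

  zeroAt0 : (ℕ → Carrier) → ℕ → Carrier
  zeroAt0 f zero    = 0#
  zeroAt0 f (suc n) = f (suc n)

  zeroAt0-pos : ∀ {f} → (∀ n → Pos (f n)) → ∀ n → Pos (zeroAt0 f n)
  zeroAt0-pos f⁺ zero    = pos-0
  zeroAt0-pos f⁺ (suc n) = f⁺ (suc n)

  -- B = L⁻¹ A for the lower bidiagonal L with unit diagonal and subdiagonal −e.
  TP<-rowRecurrence : ∀ {K A B} (e : ℕ → Carrier) → (∀ n → Pos (e n)) →
    (∀ k → B 0 k ≈ A 0 k) → (∀ n k → B (suc n) k ≈ A (suc n) k + e (suc n) * B n k) →
    TotallyPositive< K A → TotallyPositive< K B
  TP<-rowRecurrence {A = A} {B} e e⁺ B₀≈ B₊≈ =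
    TP<-rowByRow pred (λ _ → 1#) (zeroAt0 e) (λ _ → pos-1) (zeroAt0-pos e⁺)
      (λ _ → ℕₚ.≤-refl) (λ n → ℕₚ.≤-trans ℕₚ.pred[n]≤n (ℕₚ.n≤1+n n)) B≈
    where
    B≈ : ∀ n k → B n k ≈ 1# * A n k + zeroAt0 e n * splice n B A (pred n) k
    B≈ zero    k = trans (B₀≈ k) (sym (1*x+0*y≈x _ _))
    B≈ (suc n) k = trans (B₊≈ n k)
      (+-cong (sym (*-identityˡ _)) (*-congˡ (reflexive (≡.sym (splice-above B A k (ℕₚ.n<1+n n))))))

  shiftDown-suc : ∀ f s n → shiftDown R f (suc s) (suc n) ≡ shiftDown R f s n
  shiftDown-suc f zero    n = ≡.refl
  shiftDown-suc f (suc s) n = ≡.refl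

  shiftRows : ℕ → Matrix → Matrix
  shiftRows s A n k = shiftDown R (λ n′ → A n′ k) s n

  TP<-shiftRows : ∀ {K} s A → TotallyPositive< K A → TotallyPositive< K (shiftRows s A)
  TP<-shiftRows zero    A A-tp = A-tp
  TP<-shiftRows (suc s) A A-tp =
    TP<-lowerBidiagonal (λ _ → 0#) (zeroAt0 (λ _ → 1#)) (λ _ → pos-0) (zeroAt0-pos (λ _ → pos-1)) B≈
      (TP<-shiftRows s A A-tp)
    where
    B≈ : ∀ n k → shiftRows (suc s) A n k ≈ 0# * shiftRows s A n k + zeroAt0 (λ _ → 1#) n * shiftRows s A (pred n) k
    B≈ zero    k = sym (0*x+0*y≈0 _ _)
    B≈ (suc n) k = trans (reflexive (shiftDown-suc (λ n′ → A n′ k) s n)) (sym (0*x+1*y≈y _ _))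

  withUnitColumn : Matrix → Matrix
  withUnitColumn X n       (suc k) = X n k
  withUnitColumn X zero    zero    = 1#
  withUnitColumn X (suc n) zero    = 0#

  private
    withUnitColumn-off : ∀ {X n k} → 0 < k → withUnitColumn X n k ≡ X n (pred k)
    withUnitColumn-off {k = suc k} _ = ≡.refl

    withUnitColumn-below : ∀ {X n} → 0 < n → withUnitColumn X n 0 ≡ 0#
    withUnitColumn-below {n = suc n} _ = ≡.refl

    increasing-suc : ∀ {m} {f : Fin (suc m) → ℕ} → Increasing f → Increasing (f ∘ suc)
    increasing-suc f↑ i j i<j = f↑ (suc i) (suc j) (s≤s i<j)

    TP<-avoidingUnitColumn : ∀ {K X} → TotallyPositive< K X → ∀ {m} (ρ κ : Fin m → ℕ) →
      Increasing ρ → Increasing κ → (∀ j → 0 < κ j) → (∀ j → κ j < suc K) → Pos (minor (withUnitColumn X) ρ κ)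
    TP<-avoidingUnitColumn X-tp ρ κ ρ↑ κ↑ κ⁺ κ<K =
      pos-resp (det-cong _ λ i j → sym (reflexive (withUnitColumn-off (κ⁺ j))))
               (X-tp _ ρ (pred ∘ κ) ρ↑ (λ i j i<j → pred-< (κ⁺ i) (κ↑ i j i<j)) (λ j → pred-< (κ⁺ j) (κ<K j)))

  TP<-withUnitColumn : ∀ {K X} → TotallyPositive< K X → TotallyPositive< (suc K) (withUnitColumn X)
  TP<-withUnitColumn X-tp zero ρ κ _ _ _ = pos-1
  TP<-withUnitColumn {K} {X} X-tp (suc m) ρ κ ρ↑ κ↑ κ<K with κ zero ℕ.≟ 0 | ρ zero ℕ.≟ 0
  ... | no  κ₀≢0 | _        = TP<-avoidingUnitColumn {X = X} X-tp ρ κ ρ↑ κ↑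
                                (λ j → ℕₚ.<-≤-trans (ℕₚ.n≢0⇒n>0 κ₀≢0) (increasing-head≤ κ↑ j)) κ<K
  ... | yes κ₀≡0 | no  ρ₀≢0 = pos-resp
    (sym (det-zeroColumn (suc m) (λ i j → withUnitColumn X (ρ i) (κ j)) zero λ r → reflexive (≡.trans
       (≡.cong (withUnitColumn X (ρ r)) κ₀≡0)
       (withUnitColumn-below (ℕₚ.<-≤-trans (ℕₚ.n≢0⇒n>0 ρ₀≢0) (increasing-head≤ ρ↑ r))))))
    pos-0
  ... | yes κ₀≡0 | yes ρ₀≡0 = pos-resp
    (sym (det-unitColumn m Y (reflexive (≡.cong₂ (withUnitColumn X) ρ₀≡0 κ₀≡0)) λ r → reflexive (≡.trans
       (≡.cong (withUnitColumn X (ρ (suc r))) κ₀≡0)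
       (withUnitColumn-below (≡.subst (_< ρ (suc r)) ρ₀≡0 (ρ↑ zero (suc r) z<s))))))
    (TP<-avoidingUnitColumn {X = X} X-tp (ρ ∘ suc) (κ ∘ suc) (increasing-suc ρ↑) (increasing-suc κ↑)
       (λ j → ≡.subst (_< κ (suc j)) κ₀≡0 (κ↑ zero (suc j) z<s)) (κ<K ∘ suc))
    where
    Y : Square (suc m)
    Y i j = withUnitColumn X (ρ i) (κ j)

  indicator : ∀ {a} {P : Set a} → Dec P → Carrier
  indicator (yes _) = 1#
  indicator (no  _) = 0#

  indicator-cong : ∀ {a b} {P : Set a} {Q : Set b} (p? : Dec P) (q? : Dec Q) → (P → Q) → (Q → P) →
    indicator p? ≈ indicator q?
  indicator-cong (yes _) (yes _) _   _   = refl
  indicator-cong (yes p) (no ¬q) P⇒Q _   = ⊥-elim (¬q (P⇒Q p))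
  indicator-cong (no ¬p) (yes q) _   Q⇒P = ⊥-elim (¬p (Q⇒P q))
  indicator-cong (no _)  (no _)  _   _   = refl

  selection : (ℕ → ℕ) → Matrix
  selection σ n j = indicator (n ℕ.≟ σ j)

  -- A selection matrix is the unit column followed by a smaller selection matrix,
  -- shifted down by σ 0 rows.
  TP<-selection : ∀ K (σ : ℕ → ℕ) → (∀ j → σ j < σ (suc j)) → TotallyPositive< K (selection σ)
  TP<-selection zero    σ σ↑ = TP<-zero {selection σ}
  TP<-selection (suc K) σ σ↑ = TP<-resp {B = selection σ} shifted≈selection
    (TP<-shiftRows (σ 0) (withUnitColumn (selection σ′)) (TP<-withUnitColumn (TP<-selection K σ′ σ′↑)))
    where
    σ₀≤ : ∀ j → σ 0 ≤ σ j
    σ₀≤ zero    = ℕₚ.≤-refl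
    σ₀≤ (suc j) = ℕₚ.<⇒≤ (ascending⇒< σ↑ z<s)

    σ′ : ℕ → ℕ
    σ′ j = σ (suc j) ∸ σ 0

    σ′↑ : ∀ j → σ′ j < σ′ (suc j)
    σ′↑ j = ℕₚ.∸-monoˡ-< (σ↑ (suc j)) (σ₀≤ (suc j))

    column0 : ∀ {X} n → σ 0 ≤ n → withUnitColumn X (n ∸ σ 0) 0 ≈ indicator (n ℕ.≟ σ 0)
    column0 {X} n σ₀≤n = trans (column0≈ (n ∸ σ 0)) (indicator-cong (n ∸ σ 0 ℕ.≟ 0) (n ℕ.≟ σ 0)
      (λ n-σ₀≡0 → ℕₚ.≤-antisym (ℕₚ.m∸n≡0⇒m≤n n-σ₀≡0) σ₀≤n) (λ { ≡.refl → ℕₚ.n∸n≡0 n }))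
      where
      column0≈ : ∀ m → withUnitColumn X m 0 ≈ indicator (m ℕ.≟ 0)
      column0≈ zero    = refl
      column0≈ (suc m) = refl

    shifted≈selection : ∀ n k → shiftRows (σ 0) (withUnitColumn (selection σ′)) n k ≈ selection σ n k
    shifted≈selection n k with σ 0 ℕ.≤? n
    shifted≈selection n zero    | yes σ₀≤n rewrite ≤ᵇ-true σ₀≤n = column0 n σ₀≤n
    shifted≈selection n (suc k) | yes σ₀≤n rewrite ≤ᵇ-true σ₀≤n =
      indicator-cong (n ∸ σ 0 ℕ.≟ σ′ k) (n ℕ.≟ σ (suc k)) (ℕₚ.∸-cancelʳ-≡ σ₀≤n (σ₀≤ (suc k))) (≡.cong (_∸ σ 0))
    shifted≈selection n k       | no  σ₀≰n rewrite ≤ᵇ-false (ℕₚ.≰⇒> σ₀≰n) =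
      indicator-cong (no λ ()) (n ℕ.≟ σ k) (λ ()) (λ { ≡.refl → σ₀≰n (σ₀≤ k) })

record NonnegativeFactorisation {c ℓ p : Level} (R : CommutativeRing c ℓ)
    (Pos : Pred (CommutativeRing.Carrier R) p) (a : Fin 3 → ℕ → CommutativeRing.Carrier R) : Set (c ⊔ ℓ ⊔ p) where
  open CommutativeRing R hiding (zero)
  field
    α β λ′ μ : ℕ → Carrier
    α-pos : ∀ n → Pos (α n)
    β-pos : ∀ n → Pos (β n)
    λ′-pos : ∀ n → Pos (λ′ n)
    μ-pos : ∀ n → Pos (μ n)
    a₀≈ : ∀ n → a zero n ≈ α n * λ′ n
    a₁≈ : ∀ n → a (suc zero) (suc n) ≈ α (suc n) * μ (suc n) + β (suc n) * λ′ n
    a₂≈ : ∀ n → a (suc (suc zero)) (suc (suc n)) ≈ β (suc (suc n)) * μ (suc n)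

module LatticePaths {c ℓ p : Level} (R : CommutativeRing c ℓ) (Pos : Pred (CommutativeRing.Carrier R) p)
    (cone : PositiveCone R Pos) (t : ℕ) (a : Fin 3 → ℕ → CommutativeRing.Carrier R)
    (b : ℕ → CommutativeRing.Carrier R) (b-pos : ∀ n → Pos (b n)) (F : NonnegativeFactorisation R Pos a) where
  open CommutativeRing R hiding (zero)
  open NonnegativeFactorisation F
  open TotalPositivity R Pos cone
  open import Relation.Binary.Reasoning.Setoid setoid
  open import Algebra.Solver.Ring.NaturalCoefficients.Default commutativeSemiring

  λμ : (ℕ → Carrier) → ℕ → Carrier
  λμ f n = λ′ n * shiftDown R f t n + μ n * shiftDown R f (suc t) n

  -- The steps (1, t + i) of weight a⁽ⁱ⁾ factor as a step of weight λ′ or μ followed by one of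
  -- weight α or β.
  sideSteps-factorises : ∀ f n → sideSteps R t a f n ≈ α n * λμ f n + zeroAt0 β n * λμ f (pred n)
  sideSteps-factorises f zero = begin
    (a zero 0 * X + a (suc zero) 0 * 0#) + a (suc (suc zero)) 0 * 0#
      ≈⟨ +-congʳ (+-congʳ (*-congʳ (a₀≈ 0))) ⟩
    (α 0 * λ′ 0 * X + a (suc zero) 0 * 0#) + a (suc (suc zero)) 0 * 0#
      ≈⟨ solve 6 (λ α λ′ μ a₁ a₂ X → (α :* λ′ :* X :+ a₁ :* con 0) :+ a₂ :* con 0
                                  := α :* (λ′ :* X :+ μ :* con 0) :+ con 0 :* (λ′ :* X :+ μ :* con 0))
           refl (α 0) (λ′ 0) (μ 0) (a (suc zero) 0) (a (suc (suc zero)) 0) X ⟩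
    α 0 * λμ f 0 + 0# * λμ f 0 ∎
    where X = shiftDown R f t 0
  sideSteps-factorises f (suc zero) = begin
    (a zero 1 * X₁ + a (suc zero) 1 * shiftDown R f (suc t) 1) + a (suc (suc zero)) 1 * 0#
      ≈⟨ +-congʳ (+-cong (*-congʳ (a₀≈ 1)) (*-cong (a₁≈ 0) X₀≈)) ⟩
    (α 1 * λ′ 1 * X₁ + (α 1 * μ 1 + β 1 * λ′ 0) * X₀) + a (suc (suc zero)) 1 * 0#
      ≈⟨ solve 9 (λ α₁ λ₁ μ₁ β₁ λ₀ μ₀ a₂ X₁ X₀ → (α₁ :* λ₁ :* X₁ :+ (α₁ :* μ₁ :+ β₁ :* λ₀) :* X₀) :+ a₂ :* con 0
                                              := α₁ :* (λ₁ :* X₁ :+ μ₁ :* X₀) :+ β₁ :* (λ₀ :* X₀ :+ μ₀ :* con 0))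
           refl (α 1) (λ′ 1) (μ 1) (β 1) (λ′ 0) (μ 0) (a (suc (suc zero)) 1) X₁ X₀ ⟩
    α 1 * (λ′ 1 * X₁ + μ 1 * X₀) + β 1 * λμ f 0
      ≈⟨ +-congʳ (*-congˡ (+-congˡ (*-congˡ (sym X₀≈)))) ⟩
    α 1 * λμ f 1 + β 1 * λμ f 0 ∎
    where
    X₁ = shiftDown R f t 1
    X₀ = shiftDown R f t 0
    X₀≈ : shiftDown R f (suc t) 1 ≈ X₀
    X₀≈ = reflexive (shiftDown-suc f t 0)
  sideSteps-factorises f (suc (suc n)) = begin
    (a zero n₂ * X₂ + a (suc zero) n₂ * shiftDown R f (suc t) n₂)
      + a (suc (suc zero)) n₂ * shiftDown R f (suc (suc t)) n₂
      ≈⟨ +-cong (+-cong (*-congʳ (a₀≈ n₂)) (*-cong (a₁≈ (suc n)) X₁≈))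
                (*-cong (a₂≈ n) (trans (reflexive (shiftDown-suc f (suc t) (suc n))) X₀≈)) ⟩
    (α n₂ * λ′ n₂ * X₂ + (α n₂ * μ n₂ + β n₂ * λ′ n₁) * X₁) + β n₂ * μ n₁ * X₀
      ≈⟨ solve 9 (λ α₂ λ₂ μ₂ β₂ λ₁ μ₁ X₂ X₁ X₀ → (α₂ :* λ₂ :* X₂ :+ (α₂ :* μ₂ :+ β₂ :* λ₁) :* X₁) :+ β₂ :* μ₁ :* X₀
                                              := α₂ :* (λ₂ :* X₂ :+ μ₂ :* X₁) :+ β₂ :* (λ₁ :* X₁ :+ μ₁ :* X₀))
           refl (α n₂) (λ′ n₂) (μ n₂) (β n₂) (λ′ n₁) (μ n₁) X₂ X₁ X₀ ⟩
    α n₂ * (λ′ n₂ * X₂ + μ n₂ * X₁) + β n₂ * (λ′ n₁ * X₁ + μ n₁ * X₀)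
      ≈⟨ sym (+-cong (*-congˡ (+-congˡ (*-congˡ X₁≈))) (*-congˡ (+-congˡ (*-congˡ X₀≈)))) ⟩
    α n₂ * λμ f n₂ + β n₂ * λμ f n₁ ∎
    where
    n₁ = suc n
    n₂ = suc n₁
    X₂ = shiftDown R f t n₂
    X₁ = shiftDown R f t n₁
    X₀ = shiftDown R f t n
    X₁≈ : shiftDown R f (suc t) n₂ ≈ X₁
    X₁≈ = reflexive (shiftDown-suc f t n₁)
    X₀≈ : shiftDown R f (suc t) n₁ ≈ X₀
    X₀≈ = reflexive (shiftDown-suc f t n)

  private
    Z Y W : Matrix
    Z = shiftRows t (M R t a b)
    Y n k = λμ (col R t a b k) n
    W n k = α n * Y n k + zeroAt0 β n * Y (pred n) k

    Y≈ : ∀ n k → Y n k ≈ λ′ n * Z n k + zeroAt0 μ n * Z (pred n) k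
    Y≈ zero    k = +-congˡ (trans (zeroʳ (μ 0)) (sym (zeroˡ _)))
    Y≈ (suc n) k = +-congˡ (*-congˡ (reflexive (shiftDown-suc (col R t a b k) t n)))

    M₀≈ : ∀ k → M R t a b 0 k ≈ withUnitColumn W 0 k
    M₀≈ zero    = refl
    M₀≈ (suc k) = sideSteps-factorises (col R t a b k) 0

    M₊≈ : ∀ n k → M R t a b (suc n) k ≈ withUnitColumn W (suc n) k + b (suc n) * M R t a b n k
    M₊≈ n zero    = sym (+-identityˡ _)
    M₊≈ n (suc k) = trans (+-comm _ _) (+-congʳ (sideSteps-factorises (col R t a b k) (suc n)))

  M-TP< : ∀ K → TotallyPositive< K (M R t a b)
  M-TP< zero    = TP<-zero {M R t a b}
  M-TP< (suc K) = TP<-rowRecurrence {A = withUnitColumn W} {B = M R t a b} b b-pos M₀≈ M₊≈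
    (TP<-withUnitColumn
      (TP<-lowerBidiagonal {A = Y} {B = W} α (zeroAt0 β) α-pos (zeroAt0-pos β-pos) (λ _ _ → refl)
        (TP<-lowerBidiagonal {A = Z} {B = Y} λ′ (zeroAt0 μ) λ′-pos (zeroAt0-pos μ-pos) Y≈
          (TP<-shiftRows t (M R t a b) (M-TP< K)))))

  M-totallyPositive : TotallyPositive R Pos (M R t a b)
  M-totallyPositive = TP<⇒TP {M R t a b} M-TP<

module Slots (t : ℕ) where
  open import Data.Nat using (_+_; _*_)

  -- The rows come in blocks of t + 2: block x is gap x followed by shifted x r for
  -- r = t, t − 1, …, 0.  Counting r downwards makes next structural.
  data Slot : Set where
    gap     : (x : ℕ) → Slot
    shifted : (x r : ℕ) → Slot

  next : Slot → Slot
  next (gap x)             = shifted x t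
  next (shifted x zero)    = gap (suc x)
  next (shifted x (suc r)) = shifted x r

  prev : Slot → Slot
  prev (gap zero)    = gap zero
  prev (gap (suc x)) = shifted x zero
  prev (shifted x r) = if r <ᵇ t then shifted x (suc r) else gap x

  slotOf : ℕ → Slot
  slotOf = fold (gap zero) next

  WellFormed : Slot → Set
  WellFormed (gap _)       = ⊤
  WellFormed (shifted _ r) = r ≤ t

  slotOf-wellFormed : ∀ q → WellFormed (slotOf q)
  slotOf-wellFormed zero = tt
  slotOf-wellFormed (suc q) = next-wellFormed (slotOf q) (slotOf-wellFormed q)
    where
    next-wellFormed : ∀ s → WellFormed s → WellFormed (next s)
    next-wellFormed (gap x)             _   = ℕₚ.≤-refl
    next-wellFormed (shifted x zero)    _   = tt
    next-wellFormed (shifted x (suc r)) r<t = ℕₚ.<⇒≤ r<t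

  slotOf-pred : ∀ q → slotOf (pred q) ≡ prev (slotOf q)
  slotOf-pred zero    = ≡.refl
  slotOf-pred (suc q) = ≡.sym (prev-next (slotOf q) (slotOf-wellFormed q))
    where
    prev-next : ∀ s → WellFormed s → prev (next s) ≡ s
    prev-next (gap x)             _   rewrite <ᵇ-false (ℕₚ.≤-refl {t}) = ≡.refl
    prev-next (shifted x zero)    _   = ≡.refl
    prev-next (shifted x (suc r)) r<t rewrite <ᵇ-true r<t = ≡.refl

  blockSize : ℕ
  blockSize = suc (suc t)

  rowOf : Slot → ℕ
  rowOf (gap x)       = x * blockSize
  rowOf (shifted x r) = suc (t ∸ r + x * blockSize)

  rowOf-slotOf : ∀ q → rowOf (slotOf q) ≡ q
  rowOf-slotOf zero    = ≡.refl
  rowOf-slotOf (suc q) = ≡.trans (rowOf-next (slotOf q) (slotOf-wellFormed q)) (≡.cong suc (rowOf-slotOf q))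
    where
    rowOf-next : ∀ s → WellFormed s → rowOf (next s) ≡ suc (rowOf s)
    rowOf-next (gap x)             _   = ≡.cong (λ d → suc (d + x * blockSize)) (ℕₚ.n∸n≡0 t)
    rowOf-next (shifted x zero)    _   = ≡.refl
    rowOf-next (shifted x (suc r)) r<t = ≡.cong (λ d → suc (d + x * blockSize)) (m∸n≡1+m∸1+n r<t)

  slotOf-block : ∀ x → slotOf (x * blockSize) ≡ gap x
  slotOf-block zero    = ≡.refl
  slotOf-block (suc x) = begin
    fold (gap zero) next (blockSize + x * blockSize) ≡⟨ fold-+ (gap zero) next blockSize ⟩
    fold (slotOf (x * blockSize)) next blockSize     ≡⟨ ≡.cong (λ s → fold s next blockSize) (slotOf-block x) ⟩
    fold (gap x) next blockSize                      ≡⟨ iterate-is-fold (gap x) next blockSize ⟩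
    iterate next (shifted x t) (suc t)               ≡⟨ leaveBlock t ⟩
    gap (suc x)                                      ∎
    where
    open ≡.≡-Reasoning
    leaveBlock : ∀ r → iterate next (shifted x r) (suc r) ≡ gap (suc x)
    leaveBlock zero    = ≡.refl
    leaveBlock (suc r) = leaveBlock r

  bottomRow : ℕ → ℕ
  bottomRow x = suc (x * blockSize)

  bottomRow-ascending : ∀ x → bottomRow x < bottomRow (suc x)
  bottomRow-ascending x = s≤s (ℕₚ.m<n+m (x * blockSize) z<s)

  slotOf-bottomRow : ∀ x → slotOf (bottomRow x) ≡ shifted x t
  slotOf-bottomRow x = ≡.cong next (slotOf-block x)

  slotOf≡bottom⇒ : ∀ {q x} → slotOf q ≡ shifted x t → q ≡ bottomRow x
  slotOf≡bottom⇒ {q} {x} slot≡ = begin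
    q                              ≡⟨ rowOf-slotOf q ⟨
    rowOf (slotOf q)               ≡⟨ ≡.cong rowOf slot≡ ⟩
    suc (t ∸ t + x * blockSize)    ≡⟨ ≡.cong (λ d → suc (d + x * blockSize)) (ℕₚ.n∸n≡0 t) ⟩
    bottomRow x                    ∎
    where open ≡.≡-Reasoning

module RowToeplitz {c ℓ p : Level} (R : CommutativeRing c ℓ) (Pos : Pred (CommutativeRing.Carrier R) p)
    (cone : PositiveCone R Pos) (u : ℕ) (a : Fin 3 → ℕ → CommutativeRing.Carrier R)
    (b : ℕ → CommutativeRing.Carrier R) (b-pos : ∀ n → Pos (b n)) (F : NonnegativeFactorisation R Pos a) where
  open CommutativeRing R hiding (zero)
  open PositiveCone cone
  open NonnegativeFactorisation F
  open RingIdentities R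
  open TotalPositivity R Pos cone
  open LatticePaths R Pos cone (suc u) a b b-pos F using (λμ; sideSteps-factorises)
  open Slots (suc u)
  open import Relation.Binary.Reasoning.Setoid setoid
  open import Algebra.Solver.Ring.NaturalCoefficients.Default commutativeSemiring

  t : ℕ
  t = suc u

  T : ℕ → Matrix
  T = rowToeplitz R t a b

  T-inside : ∀ {x j} → j ≤ x → ∀ h → T h x j ≡ col R t a b (x ∸ j) h
  T-inside j≤x h rewrite ≤ᵇ-true j≤x = ≡.refl

  T-outside : ∀ {x j} → x < j → ∀ h → T h x j ≡ 0#
  T-outside x<j h rewrite ≤ᵇ-false x<j = ≡.refl

  M₀₊≈0 : ∀ k → M R t a b 0 (suc k) ≈ 0#
  M₀₊≈0 k = trans (+-cong (+-cong (zeroʳ _) (zeroʳ _)) (zeroʳ _)) (trans (+-identityʳ _) (+-identityʳ 0#))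

  T₀-diagonal : ∀ j → T 0 j j ≈ 1#
  T₀-diagonal j = reflexive (≡.trans (T-inside {j} ℕₚ.≤-refl 0) (≡.cong (λ k → col R t a b k 0) (ℕₚ.n∸n≡0 j)))

  T₀-offDiagonal : ∀ {x j} → x ≢ j → T 0 x j ≈ 0#
  T₀-offDiagonal {x} {j} x≢j with ℕₚ.<-cmp x j
  ... | tri< x<j _ _ = reflexive (T-outside x<j 0)
  ... | tri≈ _ x≡j _ = ⊥-elim (x≢j x≡j)
  ... | tri> _ _ j<x = trans (reflexive (≡.trans (T-inside (ℕₚ.<⇒≤ j<x) 0)
                               (≡.cong (λ k → col R t a b k 0) (m∸n≡1+m∸1+n j<x)))) (M₀₊≈0 (x ∸ suc j))

  shiftedRow : ℕ → ℕ → ℕ → ℕ → Carrier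
  shiftedRow h e x j = shiftDown R (λ h′ → T h′ x j) e h

  gapRow : ℕ → ℕ → ℕ → Carrier
  gapRow h zero    j = 0#
  gapRow h (suc x) j = λμ (λ h′ → T h′ x j) h

  λμ-cong : ∀ {f g} → (∀ h → f h ≡ g h) → ∀ n → λμ f n ≡ λμ g n
  λμ-cong {f} {g} f≗g n = ≡.cong₂ (λ x y → λ′ n * x + μ n * y) (shift t) (shift (suc t))
    where
    shift : ∀ s → shiftDown R f s n ≡ shiftDown R g s n
    shift s = ≡.cong (λ v → if s ℕ.≤ᵇ n then v else 0#) (f≗g (n ∸ s))

  gapRow-vanishes : ∀ {x j} → x ≤ j → ∀ h → gapRow h x j ≈ 0#
  gapRow-vanishes {zero}  _         h = refl
  gapRow-vanishes {suc x} x<j h = trans (reflexive (λμ-cong (T-outside x<j) h)) (trans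
    (+-cong (trans (*-congˡ (reflexive (if-eta _))) (zeroʳ _)) (trans (*-congˡ (reflexive (if-eta _))) (zeroʳ _)))
    (+-identityʳ 0#))

  T-diagonal : ∀ x h → T h x x ≡ col R t a b 0 h
  T-diagonal x h = ≡.trans (T-inside {x} ℕₚ.≤-refl h) (≡.cong (λ k → col R t a b k h) (ℕₚ.n∸n≡0 x))

  T-corner : ∀ {x j} → x ≤ j → ∀ h → T (suc h) x j ≈ b (suc h) * T h x j
  T-corner {x} {j} x≤j h with ℕₚ.m≤n⇒m<n∨m≡n x≤j
  ... | inj₁ x<j    = trans (reflexive (T-outside x<j (suc h)))
                            (sym (trans (*-congˡ (reflexive (T-outside x<j h))) (zeroʳ _)))
  ... | inj₂ ≡.refl = reflexive (≡.trans (T-diagonal x (suc h)) (≡.cong (b (suc h) *_) (≡.sym (T-diagonal x h))))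

  T-recurrence : ∀ h x j →
    T (suc h) x j ≈ b (suc h) * T h x j + (α (suc h) * gapRow (suc h) x j + β (suc h) * gapRow h x j)
  T-recurrence h x j with x ℕ.≤? j
  ... | yes x≤j = begin
    T (suc h) x j              ≈⟨ T-corner x≤j h ⟩
    b (suc h) * T h x j        ≈⟨ +-identityʳ _ ⟨
    b (suc h) * T h x j + 0#   ≈⟨ +-congˡ (trans
                                    (+-cong (*-congˡ (gapRow-vanishes x≤j (suc h))) (*-congˡ (gapRow-vanishes x≤j h)))
                                    (trans (+-cong (zeroʳ _) (zeroʳ _)) (+-identityʳ 0#))) ⟨
    b (suc h) * T h x j + (α (suc h) * gapRow (suc h) x j + β (suc h) * gapRow h x j) ∎
  T-recurrence h zero    j | no 0≰j = ⊥-elim (0≰j ℕ.z≤n)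
  T-recurrence h (suc x) j | no x+1≰j = begin
    T (suc h) (suc x) j
      ≡⟨ T≡col (suc h) ⟩
    b (suc h) * col R t a b (suc k) h + sideSteps R t a (col R t a b k) (suc h)
      ≈⟨ +-congˡ (sideSteps-factorises (col R t a b k) (suc h)) ⟩
    b (suc h) * col R t a b (suc k) h + (α (suc h) * λμ (col R t a b k) (suc h) + β (suc h) * λμ (col R t a b k) h)
      ≈⟨ +-cong (*-congˡ (reflexive (T≡col h)))
                (+-cong (*-congˡ (reflexive (gap≡ (suc h)))) (*-congˡ (reflexive (gap≡ h)))) ⟨
    b (suc h) * T h (suc x) j + (α (suc h) * gapRow (suc h) (suc x) j + β (suc h) * gapRow h (suc x) j) ∎
    where
    j≤x : j ≤ x
    j≤x = ℕₚ.≤-pred (ℕₚ.≰⇒> x+1≰j)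
    k = x ∸ j
    T≡col : ∀ n → T n (suc x) j ≡ col R t a b (suc k) n
    T≡col n = ≡.trans (T-inside (ℕₚ.m≤n⇒m≤1+n j≤x) n) (≡.cong (λ i → col R t a b i n) (ℕₚ.+-∸-assoc 1 j≤x))
    gap≡ : ∀ n → gapRow n (suc x) j ≡ λμ (col R t a b k) n
    gap≡ = λμ-cong (T-inside j≤x)

  -- Row gap x of S h is λ′ h (row x − 1 of T (h − t)) + μ h (row x − 1 of T (h − t − 1)), and
  -- zero for x = 0; row shifted x r is row x of T (h − t + r).
  content : ℕ → Slot → ℕ → Carrier
  content h (gap x)       j = gapRow h x j
  content h (shifted x r) j = shiftedRow h (t ∸ r) x j

  onRows : (Slot → ℕ → Carrier) → Matrix
  onRows F q j = F (slotOf q) j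

  S : ℕ → Matrix
  S h = onRows (content h)

  content-bottom : ∀ h x j → content h (shifted x t) j ≡ T h x j
  content-bottom h x j = ≡.cong (λ e → shiftedRow h e x j) (ℕₚ.n∸n≡0 t)

  S-bottomRow : ∀ h x j → S h (bottomRow x) j ≡ T h x j
  S-bottomRow h x j = ≡.trans (≡.cong (λ s → content h s j) (slotOf-bottomRow x)) (content-bottom h x j)

  atTop atGap : Carrier → Carrier → Slot → Carrier
  atTop x y (shifted _ zero)    = x
  atTop x y (shifted _ (suc _)) = y
  atTop x y (gap _)             = y
  atGap x y (gap _)             = x
  atGap x y (shifted _ _)       = y

  atTop-pos : ∀ {x y} → Pos x → Pos y → ∀ s → Pos (atTop x y s)
  atTop-pos x⁺ y⁺ (shifted _ zero)    = x⁺
  atTop-pos x⁺ y⁺ (shifted _ (suc _)) = y⁺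
  atTop-pos x⁺ y⁺ (gap _)             = y⁺

  atGap-pos : ∀ {x y} → Pos x → Pos y → ∀ s → Pos (atGap x y s)
  atGap-pos x⁺ y⁺ (gap _)       = x⁺
  atGap-pos x⁺ y⁺ (shifted _ _) = y⁺

  -- The row operations taking S h to S (h + 1) moved up one row: step₁ turns each top row
  -- shifted x 0 into the gap row of S (h + 1), step₂ combines the gap rows by α and β, and
  -- step₃ adds b times the following row, completing T (h + 1) x by its recurrence.
  step₁ step₂ step₃ : ℕ → Slot → ℕ → Carrier
  step₁ h s j = atTop (μ (suc h)) 1# s * content h s j + atTop (λ′ (suc h)) 0# s * content h (prev s) j
  step₂ h s j = atGap (β (suc h)) 1# s * step₁ h s j + atGap (α (suc h)) 0# s * step₁ h (prev s) j
  step₃ h s j = 1# * step₂ h s j + atGap (b (suc h)) 0# s * step₂ h (next s) j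

  step₁-belowGap : ∀ h x j → step₁ h (prev (gap x)) j ≈ gapRow (suc h) x j
  step₁-belowGap h zero    j = 1*x+0*y≈x 0# 0#
  step₁-belowGap h (suc x) j = begin
    μ (suc h) * shiftedRow h t x j + λ′ (suc h) * shiftedRow h u x j
      ≈⟨ +-comm _ _ ⟩
    λ′ (suc h) * shiftedRow h u x j + μ (suc h) * shiftedRow h t x j
      ≡⟨ ≡.cong₂ (λ y z → λ′ (suc h) * y + μ (suc h) * z)
           (shiftDown-suc (λ h′ → T h′ x j) u h) (shiftDown-suc (λ h′ → T h′ x j) t h) ⟨
    gapRow (suc h) (suc x) j ∎

  content-next : ∀ h s j → WellFormed s → content (suc h) (next s) j ≈ step₃ h s j
  content-next h (gap x) j _ = begin
    content (suc h) (shifted x t) j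
      ≡⟨ content-bottom (suc h) x j ⟩
    T (suc h) x j
      ≈⟨ T-recurrence h x j ⟩
    b (suc h) * T h x j + (α (suc h) * gapRow (suc h) x j + β (suc h) * gapRow h x j)
      ≈⟨ solve 3 (λ x y z → x :+ (y :+ z) := con 1 :* (z :+ y) :+ x) refl _ _ _ ⟩
    1# * (β (suc h) * gapRow h x j + α (suc h) * gapRow (suc h) x j) + b (suc h) * T h x j
      ≈⟨ +-cong (*-congˡ (+-cong (*-congˡ (1*x+0*y≈x _ _)) (*-congˡ (step₁-belowGap h x j))))
                (*-congˡ (trans (1*x+0*y≈x _ _) (trans (1*x+0*y≈x _ _) (reflexive (content-bottom h x j))))) ⟨
    step₃ h (gap x) j ∎
  content-next h (shifted x zero) j _ = begin
    gapRow (suc h) (suc x) j     ≈⟨ step₁-belowGap h (suc x) j ⟨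
    step₁ h (shifted x zero) j   ≈⟨ 1*x+0*y≈x _ _ ⟨
    step₂ h (shifted x zero) j   ≈⟨ 1*x+0*y≈x _ _ ⟨
    step₃ h (shifted x zero) j   ∎
  content-next h (shifted x (suc r)) j r<t = begin
    shiftedRow (suc h) (t ∸ r) x j           ≡⟨ ≡.cong (λ e → shiftedRow (suc h) e x j) (m∸n≡1+m∸1+n r<t) ⟩
    shiftedRow (suc h) (suc (t ∸ suc r)) x j ≡⟨ shiftDown-suc (λ h′ → T h′ x j) (t ∸ suc r) h ⟩
    content h (shifted x (suc r)) j          ≈⟨ 1*x+0*y≈x _ _ ⟨
    step₁ h (shifted x (suc r)) j            ≈⟨ 1*x+0*y≈x _ _ ⟨
    step₂ h (shifted x (suc r)) j            ≈⟨ 1*x+0*y≈x _ _ ⟨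
    step₃ h (shifted x (suc r)) j            ∎

  S-step : ∀ h q j → S (suc h) q j ≈ shiftRows 1 (onRows (step₃ h)) q j
  S-step h zero    j = refl
  S-step h (suc q) j = content-next h (slotOf q) j (slotOf-wellFormed q)

  content₀-vanishes : ∀ s {j} → WellFormed s → s ≢ shifted j t → content 0 s j ≈ 0#
  content₀-vanishes (gap zero)    _ _ = refl
  content₀-vanishes (gap (suc x)) _ _ = trans (+-cong (zeroʳ _) (zeroʳ _)) (+-identityʳ 0#)
  content₀-vanishes (shifted x r) {j} r≤t s≢ with ℕₚ.m≤n⇒m<n∨m≡n r≤t
  ... | inj₁ r<t    = reflexive (≡.cong (λ e → shiftedRow 0 e x j) (m∸n≡1+m∸1+n r<t))
  ... | inj₂ ≡.refl = trans (reflexive (content-bottom 0 x j)) (T₀-offDiagonal {x} {j} λ { ≡.refl → s≢ ≡.refl })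

  S₀≈selection : ∀ q j → S 0 q j ≈ selection bottomRow q j
  S₀≈selection q j with q ℕ.≟ bottomRow j
  ... | yes ≡.refl = trans (reflexive (S-bottomRow 0 j j)) (T₀-diagonal j)
  ... | no  q≢     = content₀-vanishes (slotOf q) (slotOf-wellFormed q) (q≢ ∘ slotOf≡bottom⇒)

  S-TP< : ∀ K h → TotallyPositive< K (S h)
  S-TP< K zero    = TP<-resp {B = S 0} (λ q j → sym (S₀≈selection q j))
    (TP<-selection K bottomRow bottomRow-ascending)
  S-TP< K (suc h) = TP<-resp {B = S (suc h)} (λ q j → sym (S-step h q j))
    (TP<-shiftRows 1 (onRows (step₃ h))
      (TP<-upperBidiagonal {A = onRows (step₂ h)} {B = onRows (step₃ h)}
        (λ _ → 1#) (atGap (b (suc h)) 0# ∘ slotOf) (λ _ → pos-1) (atGap-pos (b-pos _) pos-0 ∘ slotOf) (λ _ _ → refl)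
        (TP<-lowerBidiagonal {A = onRows (step₁ h)} {B = onRows (step₂ h)}
          (atGap (β (suc h)) 1# ∘ slotOf) (atGap (α (suc h)) 0# ∘ slotOf)
          (atGap-pos (β-pos _) pos-1 ∘ slotOf) (atGap-pos (α-pos _) pos-0 ∘ slotOf)
          (λ q j → +-congˡ (*-congˡ (reflexive (≡.cong (λ s → step₁ h s j) (≡.sym (slotOf-pred q))))))
          (TP<-lowerBidiagonal {A = S h} {B = onRows (step₁ h)}
            (atTop (μ (suc h)) 1# ∘ slotOf) (atTop (λ′ (suc h)) 0# ∘ slotOf)
            (atTop-pos (μ-pos _) pos-1 ∘ slotOf) (atTop-pos (λ′-pos _) pos-0 ∘ slotOf)
            (λ q j → +-congˡ (*-congˡ (reflexive (≡.cong (λ s → content h s j) (≡.sym (slotOf-pred q))))))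
            (S-TP< K h)))))

  rowToeplitz-totallyPositive : ∀ h → TotallyPositive R Pos (T h)
  rowToeplitz-totallyPositive h = TP<⇒TP {T h} λ K → TP<-resp {B = T h} (λ x j → reflexive (S-bottomRow h x j))
    (TP<-selectRows {A = S h} bottomRow bottomRow-ascending (S-TP< K h))

theorem1p5 : ∀ {c ℓ p : Level} (R : CommutativeRing c ℓ) (Pos : Pred (CommutativeRing.Carrier R) p) →
    PositiveCone R Pos →
    (t : ℕ) (a : Fin 3 → ℕ → CommutativeRing.Carrier R) (b : ℕ → CommutativeRing.Carrier R) →
    (∀ i n → Pos (a i n)) → (∀ n → Pos (b n)) →
    (α β λ′ μ : ℕ → CommutativeRing.Carrier R) →
    (∀ n → Pos (α n)) → (∀ n → Pos (β n)) → (∀ n → Pos (λ′ n)) → (∀ n → Pos (μ n)) →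
    (∀ n → CommutativeRing._≈_ R (a zero n) (CommutativeRing._*_ R (α n) (λ′ n))) →
    (∀ n → CommutativeRing._≈_ R (a (suc zero) (suc n))
      (CommutativeRing._+_ R (CommutativeRing._*_ R (α (suc n)) (μ (suc n)))
                             (CommutativeRing._*_ R (β (suc n)) (λ′ n)))) →
    (∀ n → CommutativeRing._≈_ R (a (suc (suc zero)) (suc (suc n)))
      (CommutativeRing._*_ R (β (suc (suc n))) (μ (suc n)))) →
    TotallyPositive R Pos (M R t a b)
      × (1 ≤ t → ∀ n → TotallyPositive R Pos (rowToeplitz R t a b n))
theorem1p5 R Pos cone t a b _ b-pos α β λ′ μ α-pos β-pos λ′-pos μ-pos a₀≈ a₁≈ a₂≈ =
  LatticePaths.M-totallyPositive R Pos cone t a b b-pos F , rows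
  where
  F : NonnegativeFactorisation R Pos a
  F = record
    { α = α ; β = β ; λ′ = λ′ ; μ = μ
    ; α-pos = α-pos ; β-pos = β-pos ; λ′-pos = λ′-pos ; μ-pos = μ-pos
    ; a₀≈ = a₀≈ ; a₁≈ = a₁≈ ; a₂≈ = a₂≈
    }

  rows : ∀ {t′} → 1 ≤ t′ → ∀ n → TotallyPositive R Pos (rowToeplitz R t′ a b n)
  rows {suc u} _ = RowToeplitz.rowToeplitz-totallyPositive R Pos cone u a b b-pos F
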